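{- Let $T$ be a complete first-order theory with monster model $\mathbb{M}$, let $\varphi(\bar{x};\bar{y})$ be a partitioned formula which is $d$-*maximum for some $d\in\omega$, and let $(\bar{a}_i)_{i\in I}$ be an infinite sequence of tuples from $M^{|\bar{y}|}$ indexed by a linear order $I$. Then $(\bar{a}_i)_{i\in I}$ contains an infinite subsequence which is $\Delta_\varphi(\omega)$-indiscernible.
   Context: For a partitioned formula $\varphi(\bar{x};\bar{y})$, $n\in\omega$ and $\eta:n\to 2$, let $\varphi_\eta(\bar{y}_0,\ldots,\bar{y}_{n-1})=\exists\bar{x}\bigwedge_{i<n}\varphi(\bar{x};\bar{y}_i)^{\eta(i)}$, where $\varphi^1=\varphi$, $\varphi^0=\neg\varphi$. A sequence $(\bar{a}_i)_{i\in J}$ is $\Delta_\varphi(n)$-indiscernible if for all $i_1<\cdots<i_n$ and $j_1<\cdots<j_n$ in $J$ and every $\eta:n\to2$, $\models\varphi_\eta(\bar{a}_{i_1},\ldots,\bar{a}_{i_n})\leftrightarrow\varphi_\eta(\bar{a}_{j_1},\ldots,\bar{a}_{j_n})$; it is $\Delta_\varphi(\omega)$-indiscernible if it is $\Delta_\varphi(n)$-indiscernible for all $n\in\omega$. Let $\mathcal{C}_{\varphi^*}(\mathbb{M})=\{\{\bar{b}\in M^{|\bar{y}|}:\models\varphi(\bar{a};\bar{b})\}:\bar{a}\in M^{|\bar{x}|}\}$. For $\mathcal{C}\subseteq 2^X$ and $A\subseteq X$, $\mathcal{C}(A)=\{c\cap A:c\in\mathcal{C}\}$; $\mathcal{C}$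 shatters $A$ if $\mathcal{C}(A)=2^A$; VC dimension is the supremum of sizes of shattered sets; with $\Phi_d(n)=\sum_{i=0}^d\binom ni$, $\mathcal{C}$ is $d$-maximum if its VC dimension is $d$ and $|\mathcal{C}(A)|=\Phi_d(|A|)$ for every finite $A$. $\varphi$ is $d$-*maximum if $\mathcal{C}_{\varphi^*}(\mathbb{M})$ is $d$-maximum. -}

module Defs where

open import Level using (Level; _⊔_)
open import Data.Nat using (ℕ; zero; suc; _+_; _≤_)
open import Data.Nat.Combinatorics using (_C_)
open import Data.Fin using (Fin) renaming (_<_ to _<ꟳ_)
open import Data.Bool using (Bool; true)
open import Data.Vec using (Vec; lookup)
open import Data.Product using (Σ; ∃; _×_)
open import Function using (_∘_; _⇔_)
open import Function.Definitions using (Injective)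
open import Relation.Binary.Core using (Rel)
open import Relation.Binary.PropositionalEquality using (_≡_)

Φ : ℕ → ℕ → ℕ
Φ zero    n = n C 0
Φ (suc d) n = Φ d n + n C (suc d)

module _ {ℓ : Level} {A B : Set ℓ} (φ : A → B → Set ℓ) where

  Realized : {n : ℕ} → (Fin n → B) → Vec Bool n → Set ℓ
  Realized {n} b η = ∃ λ a → (k : Fin n) → (φ a (b k) ⇔ (lookup η k ≡ true))

  Shatters : {n : ℕ} → (Fin n → B) → Set ℓ
  Shatters b = ∀ η → Realized b η

  -- |C_{φ*}({b_0,…,b_{n-1}})| = c : the realized patterns are enumerated
  -- without repetition by Fin c
  TraceCount : {n : ℕ} → (Fin n → B) → ℕ → Set ℓ
  TraceCount {n} b c =
    Σ (Fin c → Vec Bool n) λ e →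
      Injective _≡_ _≡_ e × (∀ η → Realized b η ⇔ (∃ λ j → e j ≡ η))

  VCdim : ℕ → Set ℓ
  VCdim d =
    (Σ (Fin d → B) λ b → Injective _≡_ _≡_ b × Shatters b)
    × (∀ n (b : Fin n → B) → Injective _≡_ _≡_ b → Shatters b → n ≤ d)

  Maximum : ℕ → Set ℓ
  Maximum d =
    VCdim d × (∀ n (b : Fin n → B) → Injective _≡_ _≡_ b → TraceCount b (Φ d n))

  DeltaIndiscernible : {I : Set ℓ} → Rel I ℓ → (I → B) → (I → Set ℓ) → Set ℓ
  DeltaIndiscernible {I} _<_ a J =
    ∀ (n : ℕ) (i j : Fin n → I) →
      (∀ p q → p <ꟳ q → i p < i q) → (∀ p q → p <ꟳ q → j p < j q) →
      (∀ p → J (i p)) → (∀ p → J (j p)) →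
      ∀ (η : Vec Bool n) → Realized (a ∘ i) η ⇔ Realized (a ∘ j) η

InfiniteSubset : {ℓ : Level} {I : Set ℓ} → (I → Set ℓ) → Set ℓ
InfiniteSubset {I = I} J = Σ (ℕ → I) λ f → Injective _≡_ _≡_ f × (∀ n → J (f n))

Infinite : {ℓ : Level} → Set ℓ → Set ℓ
Infinite I = Σ (ℕ → I) λ f → Injective _≡_ _≡_ f

-- By Ramsey's theorem the injective enumeration of I has a subsequence that is monotone for the
-- order of I, on which a is constant or injective, and such that each of the finitely many
-- patterns on d+1 points is realized on all of its increasing (d+1)-tuples or on none.  The range
-- of that subsequence is then Δ_φ(d+1)-indiscernible, and d-maximality upgrades this to
-- Δ_φ(ω): on n distinct points, a pattern whose restrictions to all (d+1)-subsets are realized is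
-- realized itself, for otherwise it would form, together with the Φ_d(n) realized traces, more
-- than Φ_d(n) patterns, which by the Sauer–Shelah lemma shatter d+1 points, contradicting VC
-- dimension d.  A decreasing subsequence is handled by reversing the order of I.

module Submission where

open import Defs
open import Level using (Level; 0ℓ; Lift; lift; lower)
open import Data.Nat using (ℕ; zero; suc; _+_; _≤_; _<_; _<?_; _≤′_; ≤′-refl; ≤′-step; z≤n; s≤s; _⊔_)
open import Data.Nat.Properties
  using (<-cmp; <-asym; <-trans; <-irrefl; ≤-refl; ≤-trans; ≤-<-trans; m≤m⊔n; m≤n⊔m; ≤⇒≤′; ≮⇒≥;
         ≤-reflexive; ∸-monoʳ-<; +-suc; +-comm; +-assoc; +-identityʳ; +-monoˡ-≤; +-cancelˡ-<)
open import Data.Nat.Combinatorics using (_C_; nCk+nC[k+1]≡[n+1]C[k+1])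
open import Data.Nat.Solver using (module +-*-Solver)
open import Data.Fin using (Fin; zero; suc; opposite) renaming (_<_ to _<ᶠ_)
import Data.Fin.Properties as Fin
open import Data.Bool using (Bool; true; false)
import Data.Bool.Properties as Bool
open import Data.Vec using (Vec; []; _∷_; lookup; tabulate)
import Data.Vec.Properties as Vec
open import Data.Product using (Σ; Σ-syntax; ∃; ∃-syntax; _×_; _,_; proj₁; proj₂)
open import Data.Unit using (⊤; tt)
open import Data.Empty using (⊥-elim)
open import Data.Sum using (_⊎_; inj₁; inj₂)
open import Data.List using (List; []; _∷_; length; filter; _++_)
import Data.List as List
open import Data.List.Properties using (length-++; length-tabulate)
open import Data.List.Membership.Propositional using (_∈_; _∉_)
open import Data.List.Membership.Propositional.Properties
  using (∈-++⁻; ∈-++⁺ˡ; ∈-++⁺ʳ; ∈-map⁺; ∈-filter⁻; ∈-tabulate⁻)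
open import Data.List.Relation.Unary.Any using (here; there)
open import Data.List.Relation.Unary.All.Properties using (¬Any⇒All¬; All¬⇒¬Any)
open import Data.List.Relation.Unary.Unique.Propositional using (Unique; []; _∷_)
import Data.List.Relation.Unary.Unique.Propositional.Properties as Unique
open import Data.List.Relation.Unary.All as All using (All; []; _∷_)
open import Function using (id; _∘_; flip; _⇔_; mk⇔; Equivalence)
open import Function.Definitions using (Injective)
open import Relation.Nullary using (Dec; yes; no; ¬_; ¬?; does)
import Relation.Nullary.Decidable as Dec
open import Relation.Unary using (Pred; _⊆_; Decidable)
open import Relation.Binary.Core using (Rel; _Preserves_⟶_)
open import Relation.Binary.Structures using (IsStrictTotalOrder)
open import Relation.Binary.Definitions
  using (Trichotomous; Irreflexive; Asymmetric; tri<; tri≈; tri>)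
open import Relation.Binary.PropositionalEquality
  using (_≡_; _≗_; refl; sym; trans; cong; cong₂; subst; subst₂; module ≡-Reasoning)
open import Axiom.ExcludedMiddle using (ExcludedMiddle)

module _ {a b ℓ₁ ℓ₂} {A : Set a} {B : Set b} {_<₁_ : Rel A ℓ₁} {_<₂_ : Rel B ℓ₂}
         (compare : Trichotomous _≡_ _<₁_) where

  strictlyMonotone⇒injective : Irreflexive _≡_ _<₂_ →
    ∀ {f} → f Preserves _<₁_ ⟶ _<₂_ → Injective _≡_ _≡_ f
  strictlyMonotone⇒injective irrefl mono {x} {y} fx≡fy with compare x y
  ... | tri< x<y _ _ = ⊥-elim (irrefl fx≡fy (mono x<y))
  ... | tri≈ _ x≡y _ = x≡y
  ... | tri> _ _ y<x = ⊥-elim (irrefl (sym fx≡fy) (mono y<x))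

  strictlyMonotone⇒reflects : Asymmetric _<₂_ →
    ∀ {f} → f Preserves _<₁_ ⟶ _<₂_ → ∀ {x y} → f x <₂ f y → x <₁ y
  strictlyMonotone⇒reflects asym mono {x} {y} fx<fy with compare x y
  ... | tri< x<y _ _ = x<y
  ... | tri≈ _ refl _ = ⊥-elim (asym fx<fy fx<fy)
  ... | tri> _ _ y<x = ⊥-elim (asym fx<fy (mono y<x))

module _ {g : ℕ → ℕ} (step : ∀ t → g t < g (suc t)) where

  stepwise⇒strictlyMonotone : g Preserves _<_ ⟶ _<_
  stepwise⇒strictlyMonotone t<t′ = go (≤⇒≤′ t<t′)
    where
    go : ∀ {t t′} → suc t ≤′ t′ → g t < g t′
    go {t} ≤′-refl = step t
    go (≤′-step lt) = <-trans (go lt) (step _)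

  stepwise⇒inflationary : ∀ t → t ≤ g t
  stepwise⇒inflationary zero = z≤n
  stepwise⇒inflationary (suc t) = ≤-trans (s≤s (stepwise⇒inflationary t)) (step t)

opposite-reverses : ∀ {r} {p q : Fin r} → p <ᶠ q → opposite q <ᶠ opposite p
opposite-reverses {r} {p} {q} p<q rewrite Fin.opposite-prop p | Fin.opposite-prop q =
  ∸-monoʳ-< {m = r} (s≤s p<q) (Fin.toℕ<n q)

does-true : ∀ {p} {P : Set p} (P? : Dec P) → does P? ≡ true → P
does-true (yes p) _ = p
does-true (no _) ()

does-false : ∀ {p} {P : Set p} (P? : Dec P) → does P? ≡ false → ¬ P
does-false (no ¬p) _ = ¬p
does-false (yes _) ()

ExcludedMiddle-lower : ∀ {ℓ} → ExcludedMiddle ℓ → ExcludedMiddle 0ℓ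
ExcludedMiddle-lower {ℓ} em = Dec.map′ lower lift (em {Lift ℓ _})

-- Infinite Ramsey theorem

Unbounded : Pred ℕ 0ℓ → Set
Unbounded H = ∀ n → ∃[ m ] n ≤ m × H m

Increasing : ∀ {r} → (Fin r → ℕ) → Set
Increasing v = v Preserves _<ᶠ_ ⟶ _<_

IncreasingIn : ∀ {r} → Pred ℕ 0ℓ → (Fin r → ℕ) → Set
IncreasingIn H v = (∀ p → H (v p)) × Increasing v

Homogeneous : ∀ {r} → Pred ℕ 0ℓ → (Vec ℕ r → Bool) → Bool → Set
Homogeneous H c b = ∀ v → IncreasingIn H v → c (tabulate v) ≡ b

record Thinning (H : Pred ℕ 0ℓ) (P : Pred ℕ 0ℓ → Set) : Set₁ where
  field
    subset    : Pred ℕ 0ℓ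
    unbounded : Unbounded subset
    ⊆-whole   : subset ⊆ H
    property  : P subset

Unbounded-above : ∀ {H} → Unbounded H → ∀ x → Unbounded (λ y → H y × x < y)
Unbounded-above H∞ x n with H∞ (n ⊔ suc x)
... | m , n⊔x<m , Hm = m , ≤-trans (m≤m⊔n n _) n⊔x<m , Hm , ≤-trans (m≤n⊔m n _) n⊔x<m

Colouring : Set
Colouring = Σ ℕ λ r → Vec ℕ r → Bool

HomogeneousOn : Pred ℕ 0ℓ → Colouring → Set
HomogeneousOn G (_ , c) = ∃ (Homogeneous G c)

HomogeneousOn-⊆ : ∀ {G H} → G ⊆ H → ∀ c → HomogeneousOn H c → HomogeneousOn G c
HomogeneousOn-⊆ G⊆H _ (b , hom) = b , λ v (v∈G , v-inc) → hom v ((G⊆H ∘ v∈G) , v-inc)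

MinHomogeneous : ∀ {r} → (Vec ℕ (suc r) → Bool) → (ℕ → ℕ) → (ℕ → Bool) → Set
MinHomogeneous c x k = ∀ t w → Increasing w → (∀ p → t < w p) → c (x t ∷ tabulate (x ∘ w)) ≡ k t

ConstantAlong : (ℕ → ℕ) → Colouring → Set
ConstantAlong σ (_ , c) = ∃[ b ] ∀ v → Increasing v → c (tabulate (σ ∘ v)) ≡ b

module _ (em : ExcludedMiddle 0ℓ) where

  pigeonhole : (k : ℕ → Bool) → ∃[ b ] Unbounded (λ t → k t ≡ b)
  pigeonhole k with em {Unbounded (λ t → k t ≡ true)}
  ... | yes true∞ = true , true∞
  ... | no ¬true∞ = false , false∞
    where
    false∞ : Unbounded (λ t → k t ≡ false)
    false∞ n with em {∃[ m ] n ≤ m × k m ≡ false}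
    ... | yes found = found
    ... | no none = ⊥-elim (¬true∞ true∞)
      where
      -- there is no false colour beyond n
      true∞ : Unbounded (λ t → k t ≡ true)
      true∞ n′ with k (n′ ⊔ n) in eq
      ... | true  = n′ ⊔ n , m≤m⊔n n′ n , eq
      ... | false = ⊥-elim (none (n′ ⊔ n , m≤n⊔m n′ n , eq))

  -- Pick x₀ < x₁ < … from nested unbounded sets S₀ ⊇ S₁ ⊇ …, where S (t+1) ⊆ S t is an unbounded
  -- set above x t on which the colouring c (x t ∷_) is homogeneous.
  min-homogeneous : ∀ r (c : Vec ℕ (suc r) → Bool) {H} → Unbounded H →
    Σ[ x ∈ (ℕ → ℕ) ] (∀ t → x t < x (suc t)) × (∀ t → H (x t)) × ∃ (MinHomogeneous c x)

  ramsey : ∀ r (c : Vec ℕ r → Bool) {H} → Unbounded H → Thinning H (λ G → ∃ (Homogeneous G c))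
  ramsey zero c {H} H∞ = record
    { subset = H ; unbounded = H∞ ; ⊆-whole = id ; property = c [] , λ _ _ → refl }
  ramsey (suc r) c {H} H∞ with min-homogeneous r c H∞
  ... | x , x-step , x∈H , colour , x-min-homogeneous = record
    { subset = H′ ; unbounded = H′-unbounded ; ⊆-whole = H′⊆H ; property = b , H′-homogeneous }
    where
    x-increasing : x Preserves _<_ ⟶ _<_
    x-increasing = stepwise⇒strictlyMonotone x-step

    pigeon = pigeonhole colour

    b : Bool
    b = proj₁ pigeon

    H′ : Pred ℕ 0ℓ
    H′ y = ∃[ t ] colour t ≡ b × x t ≡ y

    H′-unbounded : Unbounded H′
    H′-unbounded n with proj₂ pigeon n
    ... | t , n≤t , colour≡b = x t , ≤-trans n≤t (stepwise⇒inflationary {x} x-step t) , t , colour≡b , refl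

    H′⊆H : H′ ⊆ H
    H′⊆H (t , _ , refl) = x∈H t

    H′-homogeneous : Homogeneous H′ c b
    H′-homogeneous v (v∈H′ , v-inc) = begin
      c (tabulate v)
        ≡⟨ cong c (Vec.tabulate-cong (sym ∘ proj₂ ∘ proj₂ ∘ v∈H′)) ⟩
      c (x (index zero) ∷ tabulate (x ∘ index ∘ suc))
        ≡⟨ x-min-homogeneous (index zero) (index ∘ suc) (index-inc ∘ s≤s) (λ _ → index-inc (s≤s z≤n)) ⟩
      colour (index zero)
        ≡⟨ proj₁ (proj₂ (v∈H′ zero)) ⟩
      b ∎
      where
      open ≡-Reasoning
      index : Fin _ → ℕ
      index = proj₁ ∘ v∈H′

      index-inc : Increasing index
      index-inc {p} {q} p<q = strictlyMonotone⇒reflects {_<₂_ = _<_} <-cmp <-asym x-increasing {index p} {index q}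
        (subst₂ _<_ (sym (proj₂ (proj₂ (v∈H′ p)))) (sym (proj₂ (proj₂ (v∈H′ q)))) (v-inc p<q))

  min-homogeneous r c {H} H∞ =
    x , x-step , (λ t → antitone {0} {t} (≤⇒≤′ z≤n) (x∈S t)) , colour , x-min-homogeneous
    where
    Stage : Set₁
    Stage = Σ (Pred ℕ 0ℓ) Unbounded

    first : Stage → ℕ
    first (_ , G∞) = proj₁ (G∞ 0)

    next : (S : Stage) →
      Thinning (λ y → proj₁ S y × first S < y) (λ G → ∃ (Homogeneous G (λ w → c (first S ∷ w))))
    next S = ramsey r (λ w → c (first S ∷ w)) (Unbounded-above (proj₂ S) (first S))

    stage : ℕ → Stage
    stage zero = H , H∞
    stage (suc t) = Thinning.subset (next (stage t)) , Thinning.unbounded (next (stage t))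

    S : ℕ → Pred ℕ 0ℓ
    S t = proj₁ (stage t)

    x : ℕ → ℕ
    x t = first (stage t)

    x∈S : ∀ t → S t (x t)
    x∈S t = proj₂ (proj₂ (proj₂ (stage t) 0))

    shrink : ∀ t → S (suc t) ⊆ (λ y → S t y × x t < y)
    shrink t = Thinning.⊆-whole (next (stage t))

    antitone : ∀ {t t′} → t ≤′ t′ → S t′ ⊆ S t
    antitone ≤′-refl = id
    antitone {t′ = suc t′} (≤′-step le) = antitone le ∘ proj₁ ∘ shrink t′

    x-step : ∀ t → x t < x (suc t)
    x-step t = proj₂ (shrink t (x∈S (suc t)))

    colour : ℕ → Bool
    colour t = proj₁ (Thinning.property (next (stage t)))

    x-min-homogeneous : MinHomogeneous c x colour
    x-min-homogeneous t w w-inc above-t =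
      proj₂ (Thinning.property (next (stage t))) (x ∘ w)
        ( (λ p → antitone {suc t} {w p} (≤⇒≤′ (above-t p)) (x∈S (w p)))
        , stepwise⇒strictlyMonotone {x} x-step ∘ w-inc )

  ramsey-all : (cs : List Colouring) {H : Pred ℕ 0ℓ} → Unbounded H →
    Thinning H (λ G → All (HomogeneousOn G) cs)
  ramsey-all [] {H} H∞ = record { subset = H ; unbounded = H∞ ; ⊆-whole = id ; property = [] }
  ramsey-all ((r , c) ∷ cs) H∞ = record
    { subset = T.subset
    ; unbounded = T.unbounded
    ; ⊆-whole = R.⊆-whole ∘ T.⊆-whole
    ; property = HomogeneousOn-⊆ {T.subset} {R.subset} T.⊆-whole (r , c) R.property ∷ T.property
    }
    where
    module R = Thinning (ramsey r c H∞)
    module T = Thinning (ramsey-all cs R.unbounded)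

  -- Kept opaque: unfolding this construction during unification makes its users intractable to check.
  opaque
    ramsey-subsequence : (cs : List Colouring) →
      ∃[ σ ] σ Preserves _<_ ⟶ _<_ × All (ConstantAlong σ) cs
    ramsey-subsequence cs = σ , σ-increasing , All.map (λ {c} → constant {c}) T.property
      where
      module T = Thinning (ramsey-all cs {λ _ → ⊤} (λ n → n , ≤-refl , tt))

      σ : ℕ → ℕ
      σ zero = proj₁ (T.unbounded 0)
      σ (suc t) = proj₁ (T.unbounded (suc (σ t)))

      σ∈T : ∀ t → T.subset (σ t)
      σ∈T zero = proj₂ (proj₂ (T.unbounded 0))
      σ∈T (suc t) = proj₂ (proj₂ (T.unbounded _))

      σ-increasing : σ Preserves _<_ ⟶ _<_
      σ-increasing = stepwise⇒strictlyMonotone (λ t → proj₁ (proj₂ (T.unbounded (suc (σ t)))))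

      constant : ∀ {c} → HomogeneousOn T.subset c → ConstantAlong σ c
      constant (b , hom) = b , λ v v-inc → hom (σ ∘ v) ((λ p → σ∈T (v p)) , λ p<q → σ-increasing (v-inc p<q))

-- Sauer–Shelah lemma

length-filter-complement : ∀ {a p} {A : Set a} {P : Pred A p} (P? : Decidable P) xs →
  length xs ≡ length (filter P? xs) + length (filter (¬? ∘ P?) xs)
length-filter-complement P? [] = refl
length-filter-complement P? (x ∷ xs) with P? x
... | yes _ = cong suc (length-filter-complement P? xs)
... | no _  = trans (cong suc (length-filter-complement P? xs)) (sym (+-suc _ _))

+-<-split : ∀ {m n a b} → m + n < a + b → m < a ⊎ n < b
+-<-split {m} {n} {a} {b} lt with m <? a
... | yes m<a = inj₁ m<a
... | no m≮a = inj₂ (+-cancelˡ-< a n b (≤-<-trans (+-monoˡ-≤ n (≮⇒≥ m≮a)) lt))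

restrict : ∀ {a} {A : Set a} {n e} → Vec A n → (Fin e → Fin n) → Vec A e
restrict η s = tabulate (lookup η ∘ s)

PatternsShatter : ∀ {n e} → List (Vec Bool n) → (Fin e → Fin n) → Set
PatternsShatter F s = ∀ τ → ∃[ η ] η ∈ F × restrict η s ≡ τ

-- the number of subsets of size less than e of an n-element set
subsetsBelow : ℕ → ℕ → ℕ
subsetsBelow zero    _       = 0
subsetsBelow (suc e) zero    = 1
subsetsBelow (suc e) (suc n) = subsetsBelow (suc e) n + subsetsBelow e n

module _ {n : ℕ} where

  cofactor : Bool → List (Vec Bool (suc n)) → List (Vec Bool n)
  cofactor b [] = []
  cofactor b ((c ∷ η) ∷ F) with c Bool.≟ b
  ... | yes _ = η ∷ cofactor b F
  ... | no _  = cofactor b F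

  ∈-cofactor⁻ : ∀ b F {η} → η ∈ cofactor b F → (b ∷ η) ∈ F
  ∈-cofactor⁻ b ((c ∷ η) ∷ F) η∈ with c Bool.≟ b | η∈
  ... | yes refl | here refl = here refl
  ... | yes refl | there η∈′ = there (∈-cofactor⁻ b F η∈′)
  ... | no _     | η∈′ = there (∈-cofactor⁻ b F η∈′)

  cofactor-unique : ∀ b {F} → Unique F → Unique (cofactor b F)
  cofactor-unique b {[]} [] = []
  cofactor-unique b {(c ∷ η) ∷ F} (c∷η∉F ∷ F!) with c Bool.≟ b
  ... | yes refl = ¬Any⇒All¬ _ (λ η∈ → All¬⇒¬Any c∷η∉F (∈-cofactor⁻ b F η∈)) ∷ cofactor-unique b F!
  ... | no _ = cofactor-unique b F!

  length-cofactors : ∀ F → length F ≡ length (cofactor false F) + length (cofactor true F)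
  length-cofactors [] = refl
  length-cofactors ((false ∷ η) ∷ F) = cong suc (length-cofactors F)
  length-cofactors ((true ∷ η) ∷ F) = trans (cong suc (length-cofactors F)) (sym (+-suc _ _))

  open import Data.List.Membership.DecPropositional (Vec.≡-dec {n = n} Bool._≟_) using (_∈?_; _∉?_)

  tails∃ tails∀ : List (Vec Bool (suc n)) → List (Vec Bool n)
  tails∃ F = cofactor false F ++ filter (_∉? cofactor false F) (cofactor true F)
  tails∀ F = filter (_∈? cofactor false F) (cofactor true F)

  ∈-tails∃⁻ : ∀ F {η} → η ∈ tails∃ F → ∃[ b ] (b ∷ η) ∈ F
  ∈-tails∃⁻ F η∈ with ∈-++⁻ (cofactor false F) η∈
  ... | inj₁ η∈₀ = false , ∈-cofactor⁻ false F η∈₀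
  ... | inj₂ η∈₁ = true , ∈-cofactor⁻ true F (proj₁ (∈-filter⁻ (_∉? _) {xs = cofactor true F} η∈₁))

  ∈-tails∀⁻ : ∀ F {η} → η ∈ tails∀ F → ∀ b → (b ∷ η) ∈ F
  ∈-tails∀⁻ F η∈ false = ∈-cofactor⁻ false F (proj₂ (∈-filter⁻ (_∈? _) {xs = cofactor true F} η∈))
  ∈-tails∀⁻ F η∈ true  = ∈-cofactor⁻ true F (proj₁ (∈-filter⁻ (_∈? _) {xs = cofactor true F} η∈))

  tails∃-unique : ∀ {F} → Unique F → Unique (tails∃ F)
  tails∃-unique {F} F! = Unique.++⁺ (cofactor-unique false F!)
    (Unique.filter⁺ (_∉? cofactor false F) (cofactor-unique true F!))
    λ (η∈₀ , η∈) → proj₂ (∈-filter⁻ (_∉? cofactor false F) {xs = cofactor true F} η∈) η∈₀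

  tails∀-unique : ∀ {F} → Unique F → Unique (tails∀ F)
  tails∀-unique {F} F! = Unique.filter⁺ (_∈? cofactor false F) (cofactor-unique true F!)

  length-tails : ∀ F → length F ≡ length (tails∃ F) + length (tails∀ F)
  length-tails F = begin
    length F                                     ≡⟨ length-cofactors F ⟩
    length F₀ + length F₁                        ≡⟨ cong (length F₀ +_) (length-filter-complement (_∈? F₀) F₁) ⟩
    length F₀ + (length (tails∀ F) + length new) ≡⟨ cong (length F₀ +_) (+-comm (length (tails∀ F)) _) ⟩
    length F₀ + (length new + length (tails∀ F)) ≡⟨ +-assoc (length F₀) _ _ ⟨
    length F₀ + length new + length (tails∀ F)   ≡⟨ cong (_+ length (tails∀ F)) (length-++ F₀) ⟨
    length (tails∃ F) + length (tails∀ F)        ∎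
    where
    open ≡-Reasoning
    F₀ = cofactor false F
    F₁ = cofactor true F
    new = filter (_∉? F₀) F₁

-- Splitting on the first coordinate, |F| = |tails∃ F| + |tails∀ F| while subsetsBelow obeys
-- Pascal's rule, so one of the two tail families is too large: coordinates shattered by tails∃ F
-- are shattered by F, and coordinates shattered by tails∀ F are, together with coordinate 0.
sauer-shelah : ∀ n e (F : List (Vec Bool n)) → Unique F → subsetsBelow e n < length F →
  ∃[ s ] s Preserves _<ᶠ_ ⟶ _<ᶠ_ × PatternsShatter F s
sauer-shelah n zero (η ∷ F) _ _ = (λ ()) , (λ { {()} }) , λ { [] → η , here refl , refl }
sauer-shelah zero (suc e) ([] ∷ []) _ (s≤s ())
sauer-shelah zero (suc e) ([] ∷ [] ∷ F) ((≢[] ∷ _) ∷ _) _ = ⊥-elim (≢[] refl)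
sauer-shelah (suc n) (suc e) F F! bound
  with +-<-split (subst (subsetsBelow (suc e) n + subsetsBelow e n <_) (length-tails F) bound)
... | inj₁ bound∃ = shift (sauer-shelah n (suc e) (tails∃ F) (tails∃-unique F!) bound∃)
  where
  shift : ∃[ s ] s Preserves _<ᶠ_ ⟶ _<ᶠ_ × PatternsShatter (tails∃ F) s →
          ∃[ s ] s Preserves _<ᶠ_ ⟶ _<ᶠ_ × PatternsShatter F s
  shift (s , s-inc , shatters) = suc ∘ s , s≤s ∘ s-inc , λ τ → shifted (shatters τ)
    where
    shifted : ∀ {τ} → ∃[ η ] η ∈ tails∃ F × restrict η s ≡ τ →
                      ∃[ η ] η ∈ F × restrict η (suc ∘ s) ≡ τ
    shifted (η , η∈ , η↾s≡τ) with ∈-tails∃⁻ F η∈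
    ... | b , b∷η∈F = b ∷ η , b∷η∈F , η↾s≡τ
... | inj₂ bound∀ = extend (sauer-shelah n e (tails∀ F) (tails∀-unique F!) bound∀)
  where
  extend : ∃[ s ] s Preserves _<ᶠ_ ⟶ _<ᶠ_ × PatternsShatter (tails∀ F) s →
           ∃[ s ] s Preserves _<ᶠ_ ⟶ _<ᶠ_ × PatternsShatter F s
  extend (s , s-inc , shatters) = s′ , s′-inc , extended
    where
    s′ : Fin (suc e) → Fin (suc n)
    s′ zero = zero
    s′ (suc p) = suc (s p)

    s′-inc : s′ Preserves _<ᶠ_ ⟶ _<ᶠ_
    s′-inc {zero} {suc q} _ = s≤s z≤n
    s′-inc {suc p} {suc q} (s≤s p<q) = s≤s (s-inc p<q)

    extended : PatternsShatter F s′
    extended (b ∷ τ) with shatters τ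
    ... | η , η∈ , η↾s≡τ = b ∷ η , ∈-tails∀⁻ F η∈ b , cong (b ∷_) η↾s≡τ

-- Maximum classes

Φ-zero : ∀ d → Φ d 0 ≡ 1
Φ-zero zero = refl
Φ-zero (suc d) = trans (+-identityʳ _) (Φ-zero d)

Φ-pascal : ∀ d n → Φ (suc d) (suc n) ≡ Φ (suc d) n + Φ d n
Φ-pascal zero n = begin
  1 + suc n C 1         ≡⟨ cong (1 +_) (nCk+nC[k+1]≡[n+1]C[k+1] n 0) ⟨
  1 + (1 + n C 1)       ≡⟨ cong suc (+-comm 1 (n C 1)) ⟩
  1 + (n C 1 + 1)       ≡⟨ +-assoc 1 (n C 1) 1 ⟨
  (1 + n C 1) + 1       ∎
  where open ≡-Reasoning
Φ-pascal (suc d) n = begin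
  Φ (suc d) (suc n) + suc n C (2 + d)
    ≡⟨ cong₂ _+_ (Φ-pascal d n) (sym (nCk+nC[k+1]≡[n+1]C[k+1] n (suc d))) ⟩
  (Φ (suc d) n + Φ d n) + (n C (1 + d) + n C (2 + d))
    ≡⟨ swap-middle (Φ (suc d) n) (Φ d n) (n C (1 + d)) (n C (2 + d)) ⟩
  (Φ (suc d) n + n C (2 + d)) + (Φ d n + n C (1 + d))
    ∎
  where
  open ≡-Reasoning
  open +-*-Solver using (solve; _:+_; _:=_)
  swap-middle : ∀ w x y z → (w + x) + (y + z) ≡ (w + z) + (x + y)
  swap-middle = solve 4 (λ w x y z → (w :+ x) :+ (y :+ z) := (w :+ z) :+ (x :+ y)) refl

subsetsBelow-suc : ∀ d n → subsetsBelow (suc d) n ≡ Φ d n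
subsetsBelow-suc d zero = sym (Φ-zero d)
subsetsBelow-suc zero (suc n) = trans (+-identityʳ _) (subsetsBelow-suc zero n)
subsetsBelow-suc (suc d) (suc n) = begin
  subsetsBelow (2 + d) n + subsetsBelow (1 + d) n
    ≡⟨ cong₂ _+_ (subsetsBelow-suc (suc d) n) (subsetsBelow-suc d n) ⟩
  Φ (suc d) n + Φ d n
    ≡⟨ Φ-pascal d n ⟨
  Φ (suc d) (suc n) ∎
  where open ≡-Reasoning

module _ {ℓ} {A B : Set ℓ} (φ : A → B → Set ℓ) where

  Realized-cong : ∀ {n} {b b′ : Fin n → B} {η} → b ≗ b′ → Realized φ b η → Realized φ b′ η
  Realized-cong b≗b′ (x , x-realizes) = x , λ k → subst (λ y → φ x y ⇔ _) (b≗b′ k) (x-realizes k)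

  Realized-restrict : ∀ {n e} {b : Fin n → B} {η} (s : Fin e → Fin n) →
    Realized φ b η → Realized φ (b ∘ s) (restrict η s)
  Realized-restrict {η = η} s (x , x-realizes) =
    x , λ k → subst (λ c → φ x _ ⇔ (c ≡ true)) (sym (Vec.lookup∘tabulate (lookup η ∘ s) k)) (x-realizes (s k))

  Realized-unrestrict : ∀ {n} {b : Fin n → B} {η} (π : Fin n → Fin n) → π ∘ π ≗ id →
    Realized φ (b ∘ π) (restrict η π) → Realized φ b η
  Realized-unrestrict {b = b} {η} π involutive realized =
    Realized-cong {η = η} (cong b ∘ involutive)
      (subst (Realized φ (b ∘ π ∘ π)) restrict-twice (Realized-restrict {η = restrict η π} π realized))
    where
    restrict-twice : restrict (restrict η π) π ≡ η
    restrict-twice = trans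
      (Vec.tabulate-cong λ k → trans (Vec.lookup∘tabulate (lookup η ∘ π) (π k)) (cong (lookup η) (involutive k)))
      (Vec.tabulate∘lookup η)

module _ {ℓ} (em : ExcludedMiddle ℓ) {A B : Set ℓ} (φ : A → B → Set ℓ) {d} (maximum : Maximum φ d) where

  Maximum⇒realized-if-restrictions-realized : ∀ {n} (b : Fin n → B) → Injective _≡_ _≡_ b → ∀ η →
    (∀ (s : Fin (suc d) → Fin n) → s Preserves _<ᶠ_ ⟶ _<ᶠ_ → Realized φ (b ∘ s) (restrict η s)) →
    Realized φ b η
  Maximum⇒realized-if-restrictions-realized {n} b b-injective η restrictions-realized with em {Realized φ b η}
  ... | yes realized = realized
  ... | no unrealized = ⊥-elim (<-irrefl refl (proj₂ (proj₁ maximum) (suc d) (b ∘ s) b∘s-injective shattered))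
    where
    traces = proj₂ maximum n b b-injective
    e = proj₁ traces
    module e-complete η = Equivalence (proj₂ (proj₂ traces) η)

    η∉traces : η ∉ List.tabulate e
    η∉traces η∈ with ∈-tabulate⁻ η∈
    ... | j , η≡ej = unrealized (e-complete.from η (j , sym η≡ej))

    F! : Unique (η ∷ List.tabulate e)
    F! = ¬Any⇒All¬ _ η∉traces ∷ Unique.tabulate⁺ (proj₁ (proj₂ traces))

    bound : subsetsBelow (suc d) n < length (η ∷ List.tabulate e)
    bound = s≤s (≤-reflexive (trans (subsetsBelow-suc d n) (sym (length-tabulate e))))

    shattering = sauer-shelah n (suc d) (η ∷ List.tabulate e) F! bound
    s = proj₁ shattering

    b∘s-injective : Injective _≡_ _≡_ (b ∘ s)
    b∘s-injective = strictlyMonotone⇒injective Fin.<-cmp Fin.<-irrefl (proj₁ (proj₂ shattering)) ∘ b-injective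

    shattered : Shatters φ (b ∘ s)
    shattered τ with proj₂ (proj₂ shattering) τ
    ... | _ , here refl , η↾s≡τ =
      subst (Realized φ (b ∘ s)) η↾s≡τ (restrictions-realized s (proj₁ (proj₂ shattering)))
    ... | _ , there ζ∈ , ζ↾s≡τ with ∈-tabulate⁻ ζ∈
    ... | j , refl =
      subst (Realized φ (b ∘ s)) ζ↾s≡τ (Realized-restrict φ {η = e j} s (e-complete.from (e j) (j , refl)))

-- Indiscernibility

DeltaIndiscernibleₙ PatternTransferₙ : ∀ {ℓ} {A B I : Set ℓ} (φ : A → B → Set ℓ) →
  Rel I ℓ → (I → B) → (I → Set ℓ) → ℕ → Set ℓ
DeltaIndiscernibleₙ {I = I} φ _≺_ a J n =
  ∀ (i j : Fin n → I) →
    (∀ p q → p <ᶠ q → i p ≺ i q) → (∀ p q → p <ᶠ q → j p ≺ j q) →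
    (∀ p → J (i p)) → (∀ p → J (j p)) →
    ∀ (η : Vec Bool n) → Realized φ (a ∘ i) η ⇔ Realized φ (a ∘ j) η
PatternTransferₙ {I = I} φ _≺_ a J n =
  ∀ (i j : Fin n → I) →
    (∀ p q → p <ᶠ q → i p ≺ i q) → (∀ p q → p <ᶠ q → j p ≺ j q) →
    (∀ p → J (i p)) → (∀ p → J (j p)) →
    ∀ (η : Vec Bool n) → Realized φ (a ∘ i) η → Realized φ (a ∘ j) η

module _ {ℓ} {A B I : Set ℓ} (φ : A → B → Set ℓ) (_≺_ : Rel I ℓ) (a : I → B) (J : I → Set ℓ) where

  PatternTransferₙ⇒DeltaIndiscernibleₙ : ∀ {n} →
    PatternTransferₙ φ _≺_ a J n → DeltaIndiscernibleₙ φ _≺_ a J n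
  PatternTransferₙ⇒DeltaIndiscernibleₙ transfer i j i-inc j-inc i∈J j∈J η =
    mk⇔ (transfer i j i-inc j-inc i∈J j∈J η) (transfer j i j-inc i-inc j∈J i∈J η)

  constant⇒DeltaIndiscernible : (∀ {x y} → J x → J y → a x ≡ a y) → DeltaIndiscernible φ _≺_ a J
  constant⇒DeltaIndiscernible a-constant _ = PatternTransferₙ⇒DeltaIndiscernibleₙ
    λ i j _ _ i∈J j∈J η → Realized-cong φ {η = η} (λ p → a-constant (i∈J p) (j∈J p))

  DeltaIndiscernible-flip : DeltaIndiscernible φ (flip _≺_) a J → DeltaIndiscernible φ _≺_ a J
  DeltaIndiscernible-flip indiscernible n = PatternTransferₙ⇒DeltaIndiscernibleₙ
    λ i j i-inc j-inc i∈J j∈J η →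
      Realized-unrestrict φ {η = η} opposite Fin.opposite-involutive
      ∘ Equivalence.to (indiscernible n (i ∘ opposite) (j ∘ opposite) (reversed i-inc) (reversed j-inc)
                                      (i∈J ∘ opposite) (j∈J ∘ opposite) (restrict η opposite))
      ∘ Realized-restrict φ {η = η} opposite
    where
    reversed : ∀ {i : Fin n → I} → (∀ p q → p <ᶠ q → i p ≺ i q) →
      ∀ p q → p <ᶠ q → flip _≺_ (i (opposite p)) (i (opposite q))
    reversed i-inc p q p<q = i-inc _ _ (opposite-reverses p<q)

  module _ (em : ExcludedMiddle ℓ) {d} (maximum : Maximum φ d) where

    Maximum⇒DeltaIndiscernible : Irreflexive _≡_ _≺_ → (∀ {x y} → J x → J y → a x ≡ a y → x ≡ y) →
      DeltaIndiscernibleₙ φ _≺_ a J (suc d) → DeltaIndiscernible φ _≺_ a J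
    Maximum⇒DeltaIndiscernible ≺-irrefl a-injective indiscernible _ = PatternTransferₙ⇒DeltaIndiscernibleₙ
      λ i j i-inc j-inc i∈J j∈J η realized →
        Maximum⇒realized-if-restrictions-realized em φ maximum (a ∘ j) (a∘j-injective j-inc j∈J) η λ s s-inc →
          Equivalence.to
            (indiscernible (i ∘ s) (j ∘ s) (λ p q p<q → i-inc _ _ (s-inc p<q)) (λ p q p<q → j-inc _ _ (s-inc p<q))
                           (i∈J ∘ s) (j∈J ∘ s) (restrict η s))
            (Realized-restrict φ {η = η} s realized)
      where
      a∘j-injective : ∀ {n} {j : Fin n → I} → (∀ p q → p <ᶠ q → j p ≺ j q) → (∀ p → J (j p)) →
        Injective _≡_ _≡_ (a ∘ j)
      a∘j-injective j-inc j∈J a∘j≡ =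
        strictlyMonotone⇒injective Fin.<-cmp ≺-irrefl (j-inc _ _) (a-injective (j∈J _) (j∈J _) a∘j≡)

Range : ∀ {ℓ} {I : Set ℓ} → (ℕ → I) → I → Set ℓ
Range g x = ∃[ t ] g t ≡ x

IndiscernibleSequenceₙ : ∀ {ℓ} {A B : Set ℓ} (φ : A → B → Set ℓ) → (ℕ → B) → ℕ → Set ℓ
IndiscernibleSequenceₙ φ c n = ∀ (v w : Fin n → ℕ) → Increasing v → Increasing w →
  ∀ ζ → Realized φ (c ∘ v) ζ → Realized φ (c ∘ w) ζ

module _ {ℓ} {A B I : Set ℓ} (φ : A → B → Set ℓ) (_≺_ : Rel I ℓ) (≺-asym : Asymmetric _≺_)
         {g : ℕ → I} (g-increasing : g Preserves _<_ ⟶ _≺_) (a : I → B) where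

  Range-DeltaIndiscernibleₙ : ∀ {n} →
    IndiscernibleSequenceₙ φ (a ∘ g) n → DeltaIndiscernibleₙ φ _≺_ a (Range g) n
  Range-DeltaIndiscernibleₙ indiscernible = PatternTransferₙ⇒DeltaIndiscernibleₙ φ _≺_ a (Range g)
    λ i j i-inc j-inc i∈ j∈ ζ →
      Realized-cong φ {η = ζ} (cong a ∘ proj₂ ∘ j∈)
      ∘ indiscernible (proj₁ ∘ i∈) (proj₁ ∘ j∈) (indices-increasing i-inc i∈) (indices-increasing j-inc j∈) ζ
      ∘ Realized-cong φ {η = ζ} (cong a ∘ sym ∘ proj₂ ∘ i∈)
    where
    indices-increasing : ∀ {n} {i : Fin n → I} → (∀ p q → p <ᶠ q → i p ≺ i q) →
      (i∈ : ∀ p → Range g (i p)) → Increasing (proj₁ ∘ i∈)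
    indices-increasing {i = i} i-inc i∈ {p} {q} p<q =
      strictlyMonotone⇒reflects {_<₂_ = _≺_} <-cmp ≺-asym {g} g-increasing {proj₁ (i∈ p)} {proj₁ (i∈ q)}
        (subst₂ _≺_ (sym (proj₂ (i∈ p))) (sym (proj₂ (i∈ q))) (i-inc p q p<q))

  Range-DeltaIndiscernible : ExcludedMiddle ℓ → ∀ {d} → Maximum φ d →
    (∀ t t′ → a (g t) ≡ a (g t′)) ⊎ Injective _≡_ _≡_ (a ∘ g) →
    IndiscernibleSequenceₙ φ (a ∘ g) (suc d) → DeltaIndiscernible φ _≺_ a (Range g)
  Range-DeltaIndiscernible _ _ (inj₁ constant) _ =
    constant⇒DeltaIndiscernible φ _≺_ a (Range g) λ { (t , refl) (t′ , refl) → constant t t′ }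
  Range-DeltaIndiscernible em maximum (inj₂ injective) indiscernible =
    Maximum⇒DeltaIndiscernible φ _≺_ a (Range g) em maximum
      (λ { refl x≺x → ≺-asym x≺x x≺x })
      (λ { (t , refl) (t′ , refl) a∘g≡ → cong g (injective a∘g≡) })
      (Range-DeltaIndiscernibleₙ indiscernible)

allVecs : ∀ n → List (Vec Bool n)
allVecs zero = [] ∷ []
allVecs (suc n) = List.map (true ∷_) (allVecs n) ++ List.map (false ∷_) (allVecs n)

∈-allVecs : ∀ {n} (ζ : Vec Bool n) → ζ ∈ allVecs n
∈-allVecs [] = here refl
∈-allVecs (true ∷ ζ) = ∈-++⁺ˡ (∈-map⁺ (true ∷_) (∈-allVecs ζ))
∈-allVecs {suc n} (false ∷ ζ) = ∈-++⁺ʳ (List.map (true ∷_) (allVecs n)) (∈-map⁺ (false ∷_) (∈-allVecs ζ))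

module IndiscernibleSubsequence {ℓ} (em : ExcludedMiddle ℓ) {A B I : Set ℓ} (φ : A → B → Set ℓ) (d : ℕ)
       {_≺_ : Rel I ℓ} (≺-sto : IsStrictTotalOrder _≡_ _≺_)
       {f : ℕ → I} (f-injective : Injective _≡_ _≡_ f) (a : I → B) where

  open IsStrictTotalOrder ≺-sto using (compare) renaming (_<?_ to _≺?_)

  ordered equal : Vec ℕ 2 → Bool
  ordered (x ∷ y ∷ []) = does (f x ≺? f y)
  equal (x ∷ y ∷ []) = does (em {a (f x) ≡ a (f y)})

  realizes : Vec Bool (suc d) → Vec ℕ (suc d) → Bool
  realizes ζ v = does (em {Realized φ (a ∘ f ∘ lookup v) ζ})

  colourings : List Colouring
  colourings = (2 , ordered) ∷ (2 , equal) ∷ List.map (λ ζ → suc d , realizes ζ) (allVecs (suc d))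

  private
    thinned = ramsey-subsequence (ExcludedMiddle-lower em) colourings
    σ = proj₁ thinned
    σ-increasing = proj₁ (proj₂ thinned)
    constantAlong = proj₂ (proj₂ thinned)

  g : ℕ → I
  g = f ∘ σ

  g-injective : Injective _≡_ _≡_ g
  g-injective = strictlyMonotone⇒injective <-cmp <-irrefl σ-increasing ∘ f-injective

  pair-colour : ∀ c → ConstantAlong σ (2 , c) → ∃[ b ] ∀ {t t′} → t < t′ → c (σ t ∷ σ t′ ∷ []) ≡ b
  pair-colour c (b , constant) = b , λ t<t′ → constant _ (pair-increasing t<t′)
    where
    pair-increasing : ∀ {t t′} → t < t′ → Increasing (lookup (t ∷ t′ ∷ []))
    pair-increasing t<t′ {zero} {suc zero} _ = t<t′
    pair-increasing t<t′ {suc zero} {suc zero} (s≤s ())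

  g-monotone : g Preserves _<_ ⟶ _≺_ ⊎ g Preserves _<_ ⟶ flip _≺_
  g-monotone with pair-colour ordered (All.lookup constantAlong (here refl))
  ... | true , ascending = inj₁ λ t<t′ → does-true (_ ≺? _) (ascending t<t′)
  ... | false , descending =
    inj₂ λ {t} {t′} t<t′ → not-below (does-false (g t ≺? g t′) (descending t<t′)) t<t′
    where
    not-below : ∀ {t t′} → ¬ (g t ≺ g t′) → t < t′ → g t′ ≺ g t
    not-below {t} {t′} g≮ t<t′ with compare (g t) (g t′)
    ... | tri< below _ _ = ⊥-elim (g≮ below)
    ... | tri≈ _ g≡ _ = ⊥-elim (<-irrefl (g-injective g≡) t<t′)
    ... | tri> _ _ above = above

  g-values : (∀ t t′ → a (g t) ≡ a (g t′)) ⊎ Injective _≡_ _≡_ (a ∘ g)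
  g-values with pair-colour equal (All.lookup constantAlong (there (here refl)))
  ... | true , same = inj₁ constant
    where
    constant : ∀ t t′ → a (g t) ≡ a (g t′)
    constant t t′ with <-cmp t t′
    ... | tri< t<t′ _ _ = does-true em (same t<t′)
    ... | tri≈ _ refl _ = refl
    ... | tri> _ _ t′<t = sym (does-true em (same t′<t))
  ... | false , different = inj₂ injective
    where
    injective : Injective _≡_ _≡_ (a ∘ g)
    injective {t} {t′} a∘g≡ with <-cmp t t′
    ... | tri< t<t′ _ _ = ⊥-elim (does-false em (different t<t′) a∘g≡)
    ... | tri≈ _ t≡t′ _ = t≡t′
    ... | tri> _ _ t′<t = ⊥-elim (does-false em (different t′<t) (sym a∘g≡))

  g-indiscernible : IndiscernibleSequenceₙ φ (a ∘ g) (suc d)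
  g-indiscernible v w v-inc w-inc ζ
    with All.lookup constantAlong (there (there (∈-map⁺ (λ ζ → suc d , realizes ζ) (∈-allVecs ζ))))
  ... | _ , constant =
    Realized-cong φ {η = ζ} (tabulated w) ∘ same-colour ∘ Realized-cong φ {η = ζ} (sym ∘ tabulated v)
    where
    tabulated : ∀ u → a ∘ f ∘ lookup (tabulate (σ ∘ u)) ≗ a ∘ g ∘ u
    tabulated u = cong (a ∘ f) ∘ Vec.lookup∘tabulate (σ ∘ u)

    same-colour : Realized φ (a ∘ f ∘ lookup (tabulate (σ ∘ v))) ζ →
                  Realized φ (a ∘ f ∘ lookup (tabulate (σ ∘ w))) ζ
    same-colour realized =
      does-true em (trans (constant w w-inc) (trans (sym (constant v v-inc)) (Dec.dec-true em realized)))

corollary2p11 : {ℓ : Level} → ExcludedMiddle ℓ →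
    (M : Set ℓ) (k m : ℕ) (φ : Vec M k → Vec M m → Set ℓ) (d : ℕ) →
    Maximum φ d →
    (I : Set ℓ) (_<_ : Rel I ℓ) → IsStrictTotalOrder _≡_ _<_ →
    Infinite I →
    (a : I → Vec M m) →
    Σ (I → Set ℓ) λ J → InfiniteSubset J × DeltaIndiscernible φ _<_ a J
corollary2p11 em M k m φ d maximum I _≺_ ≺-sto (f , f-injective) a =
  Range g , (g , g-injective , λ t → t , refl) , indiscernible g-monotone
  where
  open IndiscernibleSubsequence em φ d ≺-sto f-injective a
  open IsStrictTotalOrder ≺-sto using (asym)

  indiscernible : g Preserves _<_ ⟶ _≺_ ⊎ g Preserves _<_ ⟶ flip _≺_ →
    DeltaIndiscernible φ _≺_ a (Range g)
  indiscernible (inj₁ ascending) =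
    Range-DeltaIndiscernible φ _≺_ asym ascending a em maximum g-values g-indiscernible
  indiscernible (inj₂ descending) = DeltaIndiscernible-flip φ _≺_ a (Range g)
    (Range-DeltaIndiscernible φ (flip _≺_) (λ y≺x x≺y → asym y≺x x≺y) descending a
                              em maximum g-values g-indiscernible)
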